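{- For every discrete $d$-pseudomanifold $K$, the dual graph $K^*$ is triangle-free.
   Context: All graphs are finite simple graphs. For a vertex $x$ of a graph $G$, the unit link $L(x)$ is the subgraph induced by the neighbors of $x$. Discrete pseudomanifolds are defined recursively: the empty graph is the $(-1)$-pseudomanifold; a $1$-pseudomanifold is a cycle graph $C_n$ with $n\ge4$; a discrete $d$-pseudomanifold is a finite simple graph in which every unit link is a $(d-1)$-pseudomanifold. A $j$-simplex of a graph is a complete subgraph on $j+1$ vertices. The dual graph $K^*$ of $K$ has as vertices the maximal $d$-simplices of $K$, two distinct ones being adjacent if they intersect in a $(d-1)$-simplex. -}

module Defs where

open import Data.Bool using (Bool; T)
open import Data.Nat using (ℕ; zero; suc; _+_; _%_)
open import Data.Fin using (Fin; toℕ)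
open import Data.Fin.Subset using (Subset; _∈_; _∉_; _∩_; ∣_∣; _⊂_; ⊤)
open import Data.Vec using (tabulate)
open import Data.Product using (Σ; ∃; _×_)
open import Data.Sum using (_⊎_)
open import Function.Definitions using (Injective)
open import Relation.Binary.PropositionalEquality using (_≡_; _≢_)
open import Relation.Nullary using (¬_)
open import Function.Bundles using (_⇔_)

record Graph : Set where
  field
    n     : ℕ
    E     : Fin n → Fin n → Bool
    sym   : ∀ x y → E x y ≡ E y x
    irrefl : ∀ x → ¬ T (E x x)

module _ (G : Graph) where
  open Graph G

  Adj : Fin n → Fin n → Set
  Adj x y = T (E x y)

  -- Subgraphs are always induced subgraphs of G, given by a vertex set S.
  -- Neighbourhood of x.
  nbhd : Fin n → Subset n
  nbhd x = tabulate (λ y → E x y)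

  link : Subset n → Fin n → Subset n
  link S x = S ∩ nbhd x

  -- The induced subgraph on S is isomorphic to the cycle graph C_m, m ≥ 4
  -- (m = 4 + k): vertices i and j of C_m adjacent iff j ≡ i+1 or i ≡ j+1 (mod m).
  IsCycle≥4 : Subset n → Set
  IsCycle≥4 S = ∃ λ (k : ℕ) → Σ (Fin (4 + k) → Fin n) λ f →
      Injective _≡_ _≡_ f
    × (∀ i → f i ∈ S)
    × (∀ x → x ∈ S → ∃ λ i → f i ≡ x)
    × (∀ i j → Adj (f i) (f j) ⇔
         ((suc (toℕ i) % (4 + k) ≡ toℕ j) ⊎ (suc (toℕ j) % (4 + k) ≡ toℕ i)))

  -- IsPM₊ k S : the induced subgraph on S is a discrete (k-1)-pseudomanifold.
  --   k = 0 (d = -1): the empty graph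
  --   k = 1 (d =  0): every unit link is the (-1)-pseudomanifold
  --   k = 2 (d =  1): a cycle graph C_m with m ≥ 4
  --   k ≥ 3 (d ≥  2): every unit link is a (d-1)-pseudomanifold
  IsPM₊ : ℕ → Subset n → Set
  IsPM₊ zero S = ∀ x → x ∉ S
  IsPM₊ (suc zero) S = ∀ x → x ∈ S → IsPM₊ zero (link S x)
  IsPM₊ (suc (suc zero)) S = IsCycle≥4 S
  IsPM₊ (suc (suc (suc k))) S =
    ∀ x → x ∈ S → IsPM₊ (suc (suc k)) (link S x)

  IsPseudomanifold : ℕ → Set
  IsPseudomanifold d = IsPM₊ (suc d) ⊤

  IsClique : Subset n → Set
  IsClique A = ∀ x y → x ∈ A → y ∈ A → x ≢ y → Adj x y

  -- IsSimplex₊ m A : A is a (m-1)-simplex (complete subgraph on m vertices).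
  IsSimplex₊ : ℕ → Subset n → Set
  IsSimplex₊ m A = IsClique A × ∣ A ∣ ≡ m

  IsMaximalSimplex : ℕ → Subset n → Set
  IsMaximalSimplex d A = IsSimplex₊ (suc d) A × (∀ B → A ⊂ B → ¬ IsClique B)

  DualAdj : ℕ → Subset n → Subset n → Set
  DualAdj d A B =
    IsMaximalSimplex d A × IsMaximalSimplex d B × A ≢ B × IsSimplex₊ d (A ∩ B)

  DualTriangleFree : ℕ → Set
  DualTriangleFree d =
    ∀ A B C → ¬ (DualAdj d A B × DualAdj d B C × DualAdj d A C)

-- Let A, B, C be pairwise adjacent in K*, so any two of them share a
-- (d-1)-face. If some vertex p of A ∩ B were missing from C, then
-- A = (A ∩ C) ∪ {p} and B = (B ∩ C) ∪ {p}; the vertex r of B outside A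
-- lies in C and is joined to every vertex of A (through B or C), so
-- A ∪ {r} would be a clique, contradicting maximality of A. Hence
-- F = A ∩ B lies in C as well, and the vertices of A, B, C outside F are
-- three distinct vertices joined to all of F. Taking links at the vertices
-- of F one at a time reduces this to a vertex of a cycle with three
-- distinct neighbours, which is impossible.
module Submission where

open import Defs
open import Data.Nat using (ℕ; zero; suc; _%_; _<_; _≤_; s≤s)
open import Data.Nat.Properties using (suc-injective; 0≢1+n; 1+n≢0; ≤-reflexive; <⇒≱; m≤n⇒m<n∨m≡n)
open import Data.Nat.DivMod using (n%n≡0; m≤n⇒m%n≡m)
open import Data.Bool using (T)
open import Data.Bool.Properties using (T-≡)
open import Data.Fin using (Fin; toℕ; _≟_)
open import Data.Fin.Properties using (toℕ-injective; toℕ<n; any?)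
open import Data.Fin.Subset using (Subset; inside; outside; _∈_; _∉_; _⊆_; _⊂_; _∩_; _∪_; _─_; _-_; ⁅_⁆; ∣_∣; Nonempty)
open import Data.Fin.Subset.Properties
  using (_∈?_; nonempty?; Empty-unique; ∣⊥∣≡0; p─⊥≡p; p─q⊆p; x∈p∧x≢y⇒x∈p-y; p⊆q⇒∣p∣≤∣q∣; p⊂q⇒∣p∣<∣q∣;
         x∈⁅x⁆; x∈⁅y⁆⇒x≡y; p∩q⊆p; p∩q⊆q; x∈p∩q⁺; p⊆p∪q; x∈p∪q⁺; x∈p∪q⁻; ∈⊤; ⊆⊤)
open import Data.Vec using (_∷_; tabulate)
open import Data.Vec.Properties using (lookup⇒[]=; lookup∘tabulate)
open import Data.Vec.Base using (here; there)
open import Data.Product using (∃-syntax; _×_; _,_)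
open import Data.Sum using (_⊎_; inj₁; inj₂; map₂)
open import Data.Empty using (⊥-elim)
open import Function.Bundles using (Equivalence)
open import Relation.Nullary using (¬_; yes; no; _×-dec_; ¬?)
open import Relation.Nullary.Decidable using (decidable-stable)
open import Relation.Binary.PropositionalEquality using (_≡_; _≢_; refl; sym; trans; cong; subst)

Distinct₃ : {A : Set} → A → A → A → Set
Distinct₃ a b c = a ≢ b × b ≢ c × a ≢ c

Distinct₃-map : {A B : Set} (f : A → B) {a b c : A} → Distinct₃ (f a) (f b) (f c) → Distinct₃ a b c
Distinct₃-map f (fa≢fb , fb≢fc , fa≢fc) =
  (λ e → fa≢fb (cong f e)) , (λ e → fb≢fc (cong f e)) , (λ e → fa≢fc (cong f e))

suc-%-cases : ∀ {m i} → i < suc m → suc i % suc m ≡ suc i ⊎ (i ≡ m × suc i % suc m ≡ 0)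
suc-%-cases {m} (s≤s i≤m) with m≤n⇒m<n∨m≡n i≤m
... | inj₁ i<m  = inj₁ (m≤n⇒m%n≡m i<m)
... | inj₂ refl = inj₂ (refl , n%n≡0 (suc m))

suc-%-injective : ∀ {m i j} → i < suc m → j < suc m → suc i % suc m ≡ suc j % suc m → i ≡ j
suc-%-injective i<1+m j<1+m e with suc-%-cases i<1+m | suc-%-cases j<1+m
... | inj₁ ei         | inj₁ ej         = suc-injective (trans (sym ei) (trans e ej))
... | inj₁ ei         | inj₂ (_ , ej)   = ⊥-elim (1+n≢0 (trans (sym ei) (trans e ej)))
... | inj₂ (_ , ei)   | inj₁ ej         = ⊥-elim (0≢1+n (trans (sym ei) (trans e ej)))
... | inj₂ (refl , _) | inj₂ (refl , _) = refl

CycleAdj : (m : ℕ) → Fin (suc m) → Fin (suc m) → Set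
CycleAdj m i j = (suc (toℕ i) % suc m ≡ toℕ j) ⊎ (suc (toℕ j) % suc m ≡ toℕ i)

CycleAdj-pigeonhole : ∀ {m} {i j₁ j₂ j₃ : Fin (suc m)} →
  CycleAdj m i j₁ → CycleAdj m i j₂ → CycleAdj m i j₃ → ¬ Distinct₃ j₁ j₂ j₃
CycleAdj-pigeonhole {m} {i} = pigeonhole
  where
  successor-unique : ∀ {j j′} → suc (toℕ i) % suc m ≡ toℕ j → suc (toℕ i) % suc m ≡ toℕ j′ → j ≡ j′
  successor-unique e e′ = toℕ-injective (trans (sym e) e′)

  predecessor-unique : ∀ {j j′} → suc (toℕ j) % suc m ≡ toℕ i → suc (toℕ j′) % suc m ≡ toℕ i → j ≡ j′
  predecessor-unique {j} {j′} e e′ = toℕ-injective (suc-%-injective (toℕ<n j) (toℕ<n j′) (trans e (sym e′)))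

  pigeonhole : ∀ {j₁ j₂ j₃} → CycleAdj m i j₁ → CycleAdj m i j₂ → CycleAdj m i j₃ → ¬ Distinct₃ j₁ j₂ j₃
  pigeonhole (inj₁ e₁) (inj₁ e₂) _         (≢₁₂ , _ , _) = ≢₁₂ (successor-unique e₁ e₂)
  pigeonhole (inj₂ e₁) (inj₂ e₂) _         (≢₁₂ , _ , _) = ≢₁₂ (predecessor-unique e₁ e₂)
  pigeonhole _         (inj₁ e₂) (inj₁ e₃) (_ , ≢₂₃ , _) = ≢₂₃ (successor-unique e₂ e₃)
  pigeonhole _         (inj₂ e₂) (inj₂ e₃) (_ , ≢₂₃ , _) = ≢₂₃ (predecessor-unique e₂ e₃)
  pigeonhole (inj₁ e₁) _         (inj₁ e₃) (_ , _ , ≢₁₃) = ≢₁₃ (successor-unique e₁ e₃)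
  pigeonhole (inj₂ e₁) _         (inj₂ e₃) (_ , _ , ≢₁₃) = ≢₁₃ (predecessor-unique e₁ e₃)

x∈p─q⇒x∉q : ∀ {n} (p q : Subset n) {x} → x ∈ p ─ q → x ∉ q
x∈p─q⇒x∉q (_ ∷ p) (outside ∷ q) here        = λ ()
x∈p─q⇒x∉q (_ ∷ p) (_ ∷ q)       (there x∈p─q) (there x∈q) = x∈p─q⇒x∉q p q x∈p─q x∈q

x∈p⇒∣p∣≡1+∣p-x∣ : ∀ {n} {p : Subset n} {x} → x ∈ p → ∣ p ∣ ≡ suc ∣ p - x ∣
x∈p⇒∣p∣≡1+∣p-x∣ {p = inside  ∷ p} here       = cong suc (cong ∣_∣ (sym (p─⊥≡p p)))
x∈p⇒∣p∣≡1+∣p-x∣ {p = inside  ∷ p} (there x∈p) = cong suc (x∈p⇒∣p∣≡1+∣p-x∣ x∈p)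
x∈p⇒∣p∣≡1+∣p-x∣ {p = outside ∷ p} (there x∈p) = x∈p⇒∣p∣≡1+∣p-x∣ x∈p

∣p∣≡1+k⇒Nonempty : ∀ {n} {p : Subset n} {k} → ∣ p ∣ ≡ suc k → Nonempty p
∣p∣≡1+k⇒Nonempty {n} {p} ∣p∣≡1+k with nonempty? p
... | yes p≢∅ = p≢∅
... | no  p≡∅ = ⊥-elim (0≢1+n (trans (sym (∣⊥∣≡0 n)) (trans (cong ∣_∣ (sym (Empty-unique p≡∅))) ∣p∣≡1+k)))

p⊆q⊎∃x∈p∉q : ∀ {n} (p q : Subset n) → p ⊆ q ⊎ ∃[ x ] x ∈ p × x ∉ q
p⊆q⊎∃x∈p∉q p q with any? (λ x → x ∈? p ×-dec ¬? (x ∈? q))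
... | yes x∈p∉q = inj₂ x∈p∉q
... | no  ∄x∈p∉q = inj₁ λ {x} x∈p → decidable-stable (x ∈? q) (λ x∉q → ∄x∈p∉q (x , x∈p , x∉q))

∣p∣<∣q∣⇒∃x∈q∉p : ∀ {n} {p q : Subset n} → ∣ p ∣ < ∣ q ∣ → ∃[ x ] x ∈ q × x ∉ p
∣p∣<∣q∣⇒∃x∈q∉p {p = p} {q} ∣p∣<∣q∣ with p⊆q⊎∃x∈p∉q q p
... | inj₁ q⊆p     = ⊥-elim (<⇒≱ ∣p∣<∣q∣ (p⊆q⇒∣p∣≤∣q∣ q⊆p))
... | inj₂ x∈q∉p   = x∈q∉p

p⊆q∧∣q∣≤∣p∣⇒q⊆p : ∀ {n} {p q : Subset n} → p ⊆ q → ∣ q ∣ ≤ ∣ p ∣ → q ⊆ p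
p⊆q∧∣q∣≤∣p∣⇒q⊆p {p = p} {q} p⊆q ∣q∣≤∣p∣ with p⊆q⊎∃x∈p∉q q p
... | inj₁ q⊆p     = q⊆p
... | inj₂ x∈q∉p   = ⊥-elim (<⇒≱ (p⊂q⇒∣p∣<∣q∣ (p⊆q , x∈q∉p)) ∣q∣≤∣p∣)

facet-complement : ∀ {n} {F A : Subset n} {x y} → F ⊆ A → ∣ A ∣ ≡ suc ∣ F ∣ → x ∈ A → x ∉ F →
                   y ∈ A → y ≡ x ⊎ y ∈ F
facet-complement {F = F} {A} {x} {y} F⊆A ∣A∣≡1+∣F∣ x∈A x∉F y∈A with y ≟ x
... | yes y≡x = inj₁ y≡x
... | no  y≢x = inj₂ (p⊆q∧∣q∣≤∣p∣⇒q⊆p F⊆A-x ∣A-x∣≤∣F∣ (x∈p∧x≢y⇒x∈p-y y∈A y≢x))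
  where
  F⊆A-x : F ⊆ A - x
  F⊆A-x z∈F = x∈p∧x≢y⇒x∈p-y (F⊆A z∈F) (λ { refl → x∉F z∈F })
  ∣A-x∣≤∣F∣ : ∣ A - x ∣ ≤ ∣ F ∣
  ∣A-x∣≤∣F∣ = ≤-reflexive (suc-injective (trans (sym (x∈p⇒∣p∣≡1+∣p-x∣ x∈A)) ∣A∣≡1+∣F∣))

module _ (K : Graph) where
  open Graph K using (n; E) renaming (sym to E-sym)

  Adj-sym : ∀ {x y} → Adj K x y → Adj K y x
  Adj-sym {x} {y} = subst T (E-sym x y)

  ∈link⁺ : ∀ {S x y} → y ∈ S → Adj K x y → y ∈ link K S x
  ∈link⁺ {x = x} {y} y∈S x~y =
    x∈p∩q⁺ (y∈S , lookup⇒[]= y (tabulate (E x)) (trans (lookup∘tabulate (E x) y) (Equivalence.to T-≡ x~y)))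

  IsClique-⊆ : ∀ {p q} → p ⊆ q → IsClique K q → IsClique K p
  IsClique-⊆ p⊆q q-clique x y x∈p y∈p = q-clique x y (p⊆q x∈p) (p⊆q y∈p)

  IsClique-∪⁅⁆ : ∀ {A r} → IsClique K A → (∀ {x} → x ∈ A → x ≢ r → Adj K x r) → IsClique K (A ∪ ⁅ r ⁆)
  IsClique-∪⁅⁆ {A} {r} A-clique x~r x y x∈ y∈ x≢y
    with map₂ (x∈⁅y⁆⇒x≡y r) (x∈p∪q⁻ A ⁅ r ⁆ x∈) | map₂ (x∈⁅y⁆⇒x≡y r) (x∈p∪q⁻ A ⁅ r ⁆ y∈)
  ... | inj₁ x∈A  | inj₁ y∈A  = A-clique x y x∈A y∈A x≢y
  ... | inj₁ x∈A  | inj₂ refl = x~r x∈A x≢y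
  ... | inj₂ refl | inj₁ y∈A  = Adj-sym (x~r y∈A (λ y≡x → x≢y (sym y≡x)))
  ... | inj₂ refl | inj₂ refl = ⊥-elim (x≢y refl)

  Joined : Subset n → Fin n → Set
  Joined F x = ∀ {y} → y ∈ F → Adj K y x

  IsClique⇒Joined : ∀ {X F x} → IsClique K X → F ⊆ X → x ∈ X → x ∉ F → Joined F x
  IsClique⇒Joined X-clique F⊆X x∈X x∉F {y} y∈F = X-clique y _ (F⊆X y∈F) x∈X (λ { refl → x∉F y∈F })

  cycle-degree≤2 : ∀ {S v a b c} → IsCycle≥4 K S → v ∈ S → a ∈ S → b ∈ S → c ∈ S →
                   Adj K v a → Adj K v b → Adj K v c → ¬ Distinct₃ a b c
  cycle-degree≤2 (k , f , _ , _ , onto , adj) v∈S a∈S b∈S c∈S v~a v~b v~c abc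
    with onto _ v∈S | onto _ a∈S | onto _ b∈S | onto _ c∈S
  ... | i , refl | j₁ , refl | j₂ , refl | j₃ , refl =
    CycleAdj-pigeonhole (to (adj i j₁) v~a) (to (adj i j₂) v~b) (to (adj i j₃) v~c) (Distinct₃-map f abc)
    where open Equivalence using (to)

  no-three-cofaces : ∀ k {S F a b c} → IsPM₊ K (suc (suc k)) S → F ⊆ S → IsSimplex₊ K (suc k) F →
                     a ∈ S → b ∈ S → c ∈ S → Joined F a → Joined F b → Joined F c → ¬ Distinct₃ a b c
  no-three-cofaces k {F = F} pm F⊆S (_ , ∣F∣≡1+k) a∈S b∈S c∈S F~a F~b F~c with ∣p∣≡1+k⇒Nonempty {p = F} ∣F∣≡1+k
  no-three-cofaces zero pm F⊆S _ a∈S b∈S c∈S F~a F~b F~c | x , x∈F =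
    cycle-degree≤2 pm (F⊆S x∈F) a∈S b∈S c∈S (F~a x∈F) (F~b x∈F) (F~c x∈F)
  no-three-cofaces (suc k) {S} {F} pm F⊆S (F-clique , ∣F∣≡2+k) a∈S b∈S c∈S F~a F~b F~c | x , x∈F =
    no-three-cofaces k (pm x (F⊆S x∈F)) F-x⊆link (IsClique-⊆ F-x⊆F F-clique , ∣F-x∣≡1+k)
      (∈link⁺ a∈S (F~a x∈F)) (∈link⁺ b∈S (F~b x∈F)) (∈link⁺ c∈S (F~c x∈F))
      (λ y∈ → F~a (F-x⊆F y∈)) (λ y∈ → F~b (F-x⊆F y∈)) (λ y∈ → F~c (F-x⊆F y∈))
    where
    F-x⊆F : F - x ⊆ F
    F-x⊆F = p─q⊆p F ⁅ x ⁆
    F-x⊆link : F - x ⊆ link K S x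
    F-x⊆link y∈ = ∈link⁺ (F⊆S (F-x⊆F y∈))
      (F-clique x _ x∈F (F-x⊆F y∈) (λ { refl → x∈p─q⇒x∉q F ⁅ x ⁆ y∈ (x∈⁅x⁆ x) }))
    ∣F-x∣≡1+k : ∣ F - x ∣ ≡ suc k
    ∣F-x∣≡1+k = suc-injective (trans (sym (x∈p⇒∣p∣≡1+∣p-x∣ x∈F)) ∣F∣≡2+k)

  DualTriangle : ℕ → Subset n → Subset n → Subset n → Set
  DualTriangle d A B C = DualAdj K d A B × DualAdj K d B C × DualAdj K d A C

  DualAdj⇒∣X∣≡1+∣A∩B∣ : ∀ {d A B X} → DualAdj K d A B → IsMaximalSimplex K d X → ∣ X ∣ ≡ suc ∣ A ∩ B ∣
  DualAdj⇒∣X∣≡1+∣A∩B∣ (_ , _ , _ , _ , ∣A∩B∣≡d) ((_ , ∣X∣≡1+d) , _) = trans ∣X∣≡1+d (cong suc (sym ∣A∩B∣≡d))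

  DualAdj⇒apex : ∀ {d A B X} → DualAdj K d A B → IsMaximalSimplex K d X → ∃[ x ] x ∈ X × x ∉ A ∩ B
  DualAdj⇒apex AB X-max = ∣p∣<∣q∣⇒∃x∈q∉p (≤-reflexive (sym (DualAdj⇒∣X∣≡1+∣A∩B∣ AB X-max)))

  DualTriangle⇒A∩B⊆C : ∀ {d A B C} → DualTriangle d A B C → A ∩ B ⊆ C
  DualTriangle⇒A∩B⊆C {A = A} {B} {C} (AB@(A-max@((A-clique , _) , A-maximal) , B-max@((B-clique , _) , _) , _) , BC@(_ , ((C-clique , _) , _) , _) , AC)
    with p⊆q⊎∃x∈p∉q (A ∩ B) C
  ... | inj₁ A∩B⊆C = A∩B⊆C
  ... | inj₂ (p , p∈A∩B , p∉C) with DualAdj⇒apex AB B-max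
  ...   | r , r∈B , r∉A∩B = ⊥-elim (A-maximal (A ∪ ⁅ r ⁆) A⊂A∪⁅r⁆ (IsClique-∪⁅⁆ A-clique x~r))
    where
    p∈A : p ∈ A
    p∈A = p∩q⊆p A B p∈A∩B
    p∈B : p ∈ B
    p∈B = p∩q⊆q A B p∈A∩B
    r∉A : r ∉ A
    r∉A r∈A = r∉A∩B (x∈p∩q⁺ (r∈A , r∈B))
    r∈C : r ∈ C
    r∈C with facet-complement (p∩q⊆p B C) (DualAdj⇒∣X∣≡1+∣A∩B∣ BC B-max) p∈B (λ p∈B∩C → p∉C (p∩q⊆q B C p∈B∩C)) r∈B
    ... | inj₁ refl     = ⊥-elim (r∉A p∈A)
    ... | inj₂ r∈B∩C    = p∩q⊆q B C r∈B∩C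
    x~r : ∀ {x} → x ∈ A → x ≢ r → Adj K x r
    x~r {x} x∈A x≢r with facet-complement (p∩q⊆p A C) (DualAdj⇒∣X∣≡1+∣A∩B∣ AC A-max) p∈A (λ p∈A∩C → p∉C (p∩q⊆q A C p∈A∩C)) x∈A
    ... | inj₁ refl     = B-clique x r p∈B r∈B x≢r
    ... | inj₂ x∈A∩C    = C-clique x r (p∩q⊆q A C x∈A∩C) r∈C x≢r
    A⊂A∪⁅r⁆ : A ⊂ A ∪ ⁅ r ⁆
    A⊂A∪⁅r⁆ = p⊆p∪q ⁅ r ⁆ , r , x∈p∪q⁺ (inj₂ (x∈⁅x⁆ r)) , r∉A

  DualTriangle⇒three-cofaces : ∀ {d A B C} → DualTriangle d A B C →
    ∃[ a ] ∃[ b ] ∃[ c ] Joined (A ∩ B) a × Joined (A ∩ B) b × Joined (A ∩ B) c × Distinct₃ a b c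
  DualTriangle⇒three-cofaces {A = A} {B} {C}
    △@(AB@(A-max@((A-clique , _) , _) , B-max@((B-clique , _) , _) , _ , _ , ∣A∩B∣≡d) ,
       (_ , C-max@((C-clique , _) , _) , _ , _ , ∣B∩C∣≡d) , (_ , _ , _ , _ , ∣A∩C∣≡d))
    with DualAdj⇒apex AB A-max | DualAdj⇒apex AB B-max | DualAdj⇒apex AB C-max
  ... | a , a∈A , a∉F | b , b∈B , b∉F | c , c∈C , c∉F =
    a , b , c ,
    IsClique⇒Joined A-clique (p∩q⊆p A B) a∈A a∉F ,
    IsClique⇒Joined B-clique (p∩q⊆q A B) b∈B b∉F ,
    IsClique⇒Joined C-clique F⊆C c∈C c∉F ,
    (λ { refl → a∉F (x∈p∩q⁺ (a∈A , b∈B)) }) ,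
    (λ { refl → b∉F (B∩C⊆F (x∈p∩q⁺ (b∈B , c∈C))) }) ,
    (λ { refl → a∉F (A∩C⊆F (x∈p∩q⁺ (a∈A , c∈C))) })
    where
    F⊆C : A ∩ B ⊆ C
    F⊆C = DualTriangle⇒A∩B⊆C △
    A∩C⊆F : A ∩ C ⊆ A ∩ B
    A∩C⊆F = p⊆q∧∣q∣≤∣p∣⇒q⊆p (λ x∈F → x∈p∩q⁺ (p∩q⊆p A B x∈F , F⊆C x∈F)) (≤-reflexive (trans ∣A∩C∣≡d (sym ∣A∩B∣≡d)))
    B∩C⊆F : B ∩ C ⊆ A ∩ B
    B∩C⊆F = p⊆q∧∣q∣≤∣p∣⇒q⊆p (λ x∈F → x∈p∩q⁺ (p∩q⊆q A B x∈F , F⊆C x∈F)) (≤-reflexive (trans ∣B∩C∣≡d (sym ∣A∩B∣≡d)))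

proposition3p5 : (K : Graph) (d : ℕ) → IsPseudomanifold K (suc d) → DualTriangleFree K (suc d)
proposition3p5 K d pm A B C △@((_ , _ , _ , A∩B-simplex) , _) with DualTriangle⇒three-cofaces K △
... | a , b , c , A∩B~a , A∩B~b , A∩B~c , distinct =
  no-three-cofaces K d pm ⊆⊤ A∩B-simplex ∈⊤ ∈⊤ ∈⊤ A∩B~a A∩B~b A∩B~c distinct
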